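{- Let $m\ge 3$ and let $S$ and $T$ be numerical semigroups of multiplicity $m$. Then the Kunz coordinates of $S$ and the Kunz coordinates of $T$ lie in the relative interior of the same face of the relaxed Kunz polyhedron $P'_m$ if and only if $\mathcal P(S)=\mathcal P(T)$.
   Context: A numerical semigroup is a subset $S\subseteq\mathbb Z_{\ge 0}$ containing $0$, closed under addition, with finite complement in $\mathbb Z_{\ge0}$; its multiplicity is $m=\min(S\setminus\{0\})$. Write $\mathrm{Ap}(S;m)=\{s\in S: s-m\notin S\}=\{0,a_1,\dots,a_{m-1}\}$ with $a_i=\min\{s\in S:s\equiv i\bmod m\}$, and $a_i=k_im+i$ with $k_i$ a positive integer; the vector $(k_1,\dots,k_{m-1})$ is the Kunz coordinate vector of $S$. Indices of coordinates $x_i$ are regarded as nonzero elements of $\mathbb Z/(m)$ (represented by $1,\dots,m-1$). The relaxed Kunz polyhedron $P'_m\subseteq\mathbb R^{m-1}$ is the set of points $(x_1,\dots,x_{m-1})$ satisfying $x_i+x_j\ge x_{i+j}$ for $1\le i\le j\le m-1$ with $i+j<m$, and $x_i+x_j+1\ge x_{i+j-m}$ for $1\le i\le j\le m-1$ with $i+j>m$. (Kunz coordinates of numerical semigroups of multiplicity $m$ are points of $P'_m$.) The Apéry poset of $S$ is $\mathcal P(S)=(\mathbb Z/(m)\setminus\{0\},\preceq)$ with $i\preceq j$ iff $a_j-a_i\in S$. The interior of a face means its relative interior. -}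

module Defs where

open import Data.Nat using (ℕ; _+_; _*_; _∸_; _≤_; _<_; _<ᵇ_)
open import Data.Integer using (+_)
open import Data.Rational using (ℚ; 1ℚ; _/_) renaming (_+_ to _+ℚ_; _≤_ to _≤ℚ_)
open import Data.Bool using (Bool; true; if_then_else_)
open import Data.Product using (Σ; ∃; _×_)
open import Relation.Binary.PropositionalEquality using (_≡_; _≢_)
open import Function.Bundles using (_⇔_)

record NumericalSemigroup (S : ℕ → Set) : Set where
  field
    zero∈   : S 0
    closed  : ∀ a b → S a → S b → S (a + b)
    cofinite : ∃ λ N → ∀ n → N ≤ n → S n

Multiplicity : (ℕ → Set) → ℕ → Set
Multiplicity S m = S m × (0 < m) × (∀ s → S s → 0 < s → m ≤ s)

-- k is the Kunz coordinate vector of S (w.r.t. m): for 1 ≤ i ≤ m-1,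
-- a_i = k i * m + i is the least element of S congruent to i mod m.
-- (Values of k outside 1..m-1 are irrelevant.)
IsKunzVector : (ℕ → Set) → ℕ → (ℕ → ℕ) → Set
IsKunzVector S m k = ∀ i → 1 ≤ i → i < m →
  S (k i * m + i) × (∀ q → S (q * m + i) → k i ≤ q)

apery : ℕ → (ℕ → ℕ) → ℕ → ℕ
apery m k i = k i * m + i

AperyLeq : (ℕ → Set) → ℕ → (ℕ → ℕ) → ℕ → ℕ → Set
AperyLeq S m k i j = ∃ λ s → S s × (apery m k i + s ≡ apery m k j)

SameAperyPoset : (ℕ → Set) → (ℕ → ℕ) → (ℕ → Set) → (ℕ → ℕ) → ℕ → Set
SameAperyPoset S kS T kT m = ∀ i j → 1 ≤ i → i < m → 1 ≤ j → j < m →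
  AperyLeq S m kS i j ⇔ AperyLeq T m kT i j

-- Points of ℚ^{m-1}: functions ℕ → ℚ, only coordinates 1..m-1 matter.
Point : Set
Point = ℕ → ℚ

ValidPair : ℕ → ℕ → ℕ → Set
ValidPair m i j = (1 ≤ i) × (i ≤ j) × (j < m) × (i + j ≢ m)

lhs : ℕ → Point → ℕ → ℕ → ℚ
lhs m x i j = if i + j <ᵇ m then x i +ℚ x j else (x i +ℚ x j) +ℚ 1ℚ

tgt : ℕ → ℕ → ℕ → ℕ
tgt m i j = if i + j <ᵇ m then i + j else i + j ∸ m

InRelaxedKunz : ℕ → Point → Set
InRelaxedKunz m x = ∀ i j → ValidPair m i j → x (tgt m i j) ≤ℚ lhs m x i j

InFace : ℕ → (ℕ → ℕ → Bool) → Point → Set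
InFace m I x = InRelaxedKunz m x ×
  (∀ i j → ValidPair m i j → I i j ≡ true → x (tgt m i j) ≡ lhs m x i j)

-- Relative interior of F_I: points of F_I lying in no face properly
-- contained in F_I.
InRelInt : ℕ → (ℕ → ℕ → Bool) → Point → Set
InRelInt m I x = InFace m I x ×
  (∀ J → InFace m J x → (∀ y → InFace m J y → InFace m I y) →
         ∀ y → InFace m I y → InFace m J y)

kunzPoint : (ℕ → ℕ) → Point
kunzPoint k i = (+ k i) / 1

{-# OPTIONS --safe #-}
module Submission where

-- A point x of P'_m lies in the relative interior of exactly one face: the one cut out by the
-- inequalities that x satisfies with equality. So two points share a face interior iff they have
-- the same tight inequalities. For the Kunz vector of S, a_i + a_j = (k_i + k_j + ε) m + (i + j mod m)
-- with carry ε ∈ {0, 1}, so the inequality (i, j) is tight iff a_{i+j} = a_i + a_j. As a_j is the least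
-- element of S in its residue class, this holds iff a_{i+j} - a_i ∈ S, i.e. iff i ⪯ i + j.
-- Every pair i ≠ t of nonzero residues is of the form (i, i + j), so the tight inequalities and the
-- Apéry poset determine each other.

open import Defs
open import Data.Nat using (ℕ; _≤_)
open import Data.Bool using (Bool)
open import Data.Product using (Σ; _×_)
open import Function.Bundles using (_⇔_)

open import Data.Nat using (zero; suc; _+_; _*_; _∸_; _<_; _<ᵇ_; _≡ᵇ_)
open import Data.Nat.Properties
open import Data.Nat.Tactic.RingSolver using (solve)
open import Algebra.Properties.CommutativeSemigroup +-commutativeSemigroup using (xy∙z≈xz∙y; x∙yz≈xz∙y)
import Data.Nat.Coprimality as Coprimality
open import Data.Integer as ℤ using (+≤+)
import Data.Integer.Properties as ℤP
open import Data.Rational using (ℚ; mkℚ; 1ℚ; _/_; *≤*) renaming (_+_ to _+ℚ_; _≤_ to _≤ℚ_)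
open import Data.Rational.Properties using (fromℚᵘ-toℚᵘ; /-cong) renaming (_≟_ to _≟ℚ_; +-comm to +ℚ-comm)
open import Data.Bool using (true; false; if_then_else_; T; _∨_; _∧_)
open import Data.Bool.Properties using (T-≡; T-∨; T-∧)
open import Data.Product using (_,_; proj₁; proj₂; ∃)
open import Data.Sum using (_⊎_; inj₁; inj₂)
open import Data.List using (_∷_; [])
open import Data.Empty using (⊥-elim)
open import Relation.Nullary using (yes; no; does)
open import Relation.Nullary.Reflects using (ofʸ; ofⁿ)
open import Relation.Nullary.Decidable using (dec-true)
open import Relation.Binary.Definitions using (tri<; tri≈; tri>)
open import Relation.Binary.PropositionalEquality
  using (_≡_; _≢_; refl; sym; trans; cong; cong₂; subst; module ≡-Reasoning)
open import Function using (_∘_)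
open import Function.Bundles using (mk⇔; Equivalence)
import Function.Properties.Equivalence as ⇔

open Equivalence using (to; from)

fromℕ : ℕ → ℚ
fromℕ n = ℤ.+ n / 1

fromℕ-normal : ∀ n → fromℕ n ≡ mkℚ (ℤ.+ n) 0 (Coprimality.sym (Coprimality.1-coprimeTo n))
fromℕ-normal n = fromℚᵘ-toℚᵘ _

fromℕ-+ : ∀ a b → fromℕ (a + b) ≡ fromℕ a +ℚ fromℕ b
fromℕ-+ a b rewrite fromℕ-normal a | fromℕ-normal b =
  /-cong (trans (ℤP.pos-+ a b) (sym (cong₂ ℤ._+_ (ℤP.*-identityʳ (ℤ.+ a)) (ℤP.*-identityʳ (ℤ.+ b))))) refl

fromℕ-injective : ∀ {a b} → fromℕ a ≡ fromℕ b → a ≡ b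
fromℕ-injective {a} {b} eq rewrite fromℕ-normal a | fromℕ-normal b = ℤP.+-injective (cong ℚ.numerator eq)

fromℕ-mono-≤ : ∀ {a b} → a ≤ b → fromℕ a ≤ℚ fromℕ b
fromℕ-mono-≤ {a} {b} a≤b rewrite fromℕ-normal a | fromℕ-normal b =
  *≤* (ℤP.*-monoʳ-≤-nonNeg (ℤ.+ 1) (+≤+ a≤b))

Index : ℕ → ℕ → Set
Index m i = 1 ≤ i × i < m

carry : ℕ → ℕ → ℕ → ℕ
carry m i j = if i + j <ᵇ m then 0 else 1

+≡tgt+carry*m : ∀ m i j → i + j ≡ tgt m i j + carry m i j * m
+≡tgt+carry*m m i j with i + j <ᵇ m | <ᵇ-reflects-< (i + j) m
... | true  | _          = sym (+-identityʳ (i + j))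
... | false | ofⁿ i+j≮m = begin
  i + j               ≡⟨ m∸n+n≡m (≮⇒≥ i+j≮m) ⟨
  i + j ∸ m + m       ≡⟨ cong (i + j ∸ m +_) (+-identityʳ m) ⟨
  i + j ∸ m + 1 * m   ∎
  where open ≡-Reasoning

tgt-< : ∀ {m} i j → i + j < m → tgt m i j ≡ i + j
tgt-< {m} i j i+j<m with i + j <ᵇ m | <ᵇ-reflects-< (i + j) m
... | true  | _          = refl
... | false | ofⁿ i+j≮m = ⊥-elim (i+j≮m i+j<m)

tgt-≥ : ∀ {m} i j → m ≤ i + j → tgt m i j ≡ i + j ∸ m
tgt-≥ {m} i j m≤i+j with i + j <ᵇ m | <ᵇ-reflects-< (i + j) m
... | true  | ofʸ i+j<m = ⊥-elim (<⇒≱ i+j<m m≤i+j)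
... | false | _          = refl

tgt-index : ∀ {m i j} → Index m i → Index m j → i + j ≢ m → Index m (tgt m i j)
tgt-index {m} {i} {j} (1≤i , i<m) (_ , j<m) i+j≢m with m ≤? i + j
... | no  m≰i+j = subst (Index m) (sym (tgt-< i j (≰⇒> m≰i+j))) (≤-trans 1≤i (m≤m+n i j) , ≰⇒> m≰i+j)
... | yes m≤i+j = subst (Index m) (sym (tgt-≥ i j m≤i+j)) (m<n⇒0<n∸m m<i+j , i+j∸m<m)
  where
    m<i+j : m < i + j
    m<i+j = ≤∧≢⇒< m≤i+j (i+j≢m ∘ sym)
    i+j∸m<m : i + j ∸ m < m
    i+j∸m<m = subst (i + j ∸ m <_) (m+n∸n≡m m m) (∸-monoˡ-< (+-mono-< i<m j<m) m≤i+j)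

validPair⇒index : ∀ {m i j} → ValidPair m i j → Index m i × Index m j
validPair⇒index (1≤i , i≤j , j<m , _) = (1≤i , ≤-<-trans i≤j j<m) , (≤-trans 1≤i i≤j , j<m)

tgt-onto : ∀ {m i j} → Index m i → Index m j → i ≢ j →
           ∃ λ d → Index m d × i + d ≢ m × tgt m i d ≡ j
tgt-onto {m} {i} {j} (1≤i , i<m) (1≤j , j<m) i≢j with <-cmp i j
... | tri≈ _ i≡j _ = ⊥-elim (i≢j i≡j)
... | tri< i<j _ _ = j ∸ i , d∈ , <⇒≢ i+d<m , trans (tgt-< i (j ∸ i) i+d<m) i+d≡j
  where
    i+d≡j : i + (j ∸ i) ≡ j
    i+d≡j = m+[n∸m]≡n (<⇒≤ i<j)
    i+d<m : i + (j ∸ i) < m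
    i+d<m = subst (_< m) (sym i+d≡j) j<m
    d∈ : Index m (j ∸ i)
    d∈ = m<n⇒0<n∸m i<j , ≤-<-trans (m∸n≤m j i) j<m
... | tri> _ _ j<i = m ∸ i + j , d∈ , >⇒≢ m<i+d , (begin
  tgt m i (m ∸ i + j) ≡⟨ tgt-≥ i (m ∸ i + j) (<⇒≤ m<i+d) ⟩
  i + (m ∸ i + j) ∸ m ≡⟨ cong (_∸ m) i+d≡m+j ⟩
  m + j ∸ m           ≡⟨ m+n∸m≡n m j ⟩
  j                   ∎)
  where
    open ≡-Reasoning
    i+d≡m+j : i + (m ∸ i + j) ≡ m + j
    i+d≡m+j = trans (sym (+-assoc i (m ∸ i) j)) (cong (_+ j) (m+[n∸m]≡n (<⇒≤ i<m)))
    m<i+d : m < i + (m ∸ i + j)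
    m<i+d = subst (m <_) (sym i+d≡m+j) (m<m+n m 1≤j)
    d∈ : Index m (m ∸ i + j)
    d∈ = ≤-trans 1≤j (m≤n+m j (m ∸ i)) , subst (m ∸ i + j <_) (m∸n+n≡m (<⇒≤ i<m)) (+-monoʳ-< (m ∸ i) j<i)

tgt-comm : ∀ m i j → tgt m i j ≡ tgt m j i
tgt-comm m i j = cong (λ n → if n <ᵇ m then n else n ∸ m) (+-comm i j)

lhs-comm : ∀ m x i j → lhs m x i j ≡ lhs m x j i
lhs-comm m x i j rewrite +-comm i j with j + i <ᵇ m
... | true  = +ℚ-comm (x i) (x j)
... | false = cong (_+ℚ 1ℚ) (+ℚ-comm (x i) (x j))

a*m+s≡b*m+r⇒s≡q*m+r : ∀ {m r} a b s → r < m → a * m + s ≡ b * m + r →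
                      ∃ λ q → a + q ≡ b × s ≡ q * m + r
a*m+s≡b*m+r⇒s≡q*m+r zero b s _ eq = b , refl , eq
a*m+s≡b*m+r⇒s≡q*m+r {m} (suc a) zero s r<m eq =
  ⊥-elim (<⇒≱ r<m (subst (m ≤_) eq (≤-trans (m≤m+n m (a * m)) (m≤m+n (m + a * m) s))))
a*m+s≡b*m+r⇒s≡q*m+r {m} {r} (suc a) (suc b) s r<m eq
  with q , a+q≡b , s≡q*m+r ← a*m+s≡b*m+r⇒s≡q*m+r a b s r<m
         (+-cancelˡ-≡ m _ _ (trans (sym (+-assoc m (a * m) s)) (trans eq (+-assoc m (b * m) r))))
  = q , cong suc a+q≡b , s≡q*m+r

Tight : ℕ → Point → ℕ → ℕ → Set
Tight m x i j = x (tgt m i j) ≡ lhs m x i j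

tight-comm : ∀ m x i j → Tight m x i j ⇔ Tight m x j i
tight-comm m x i j = mk⇔ (swap i j) (swap j i)
  where swap : ∀ i j → Tight m x i j → Tight m x j i
        swap i j tight = trans (cong x (tgt-comm m j i)) (trans tight (lhs-comm m x i j))

SameTight : ℕ → Point → Point → Set
SameTight m x z = ∀ i j → ValidPair m i j → Tight m x i j ⇔ Tight m z i j

sameTight-unordered : ∀ {m} x z {i j} → SameTight m x z → Index m i → Index m j → i + j ≢ m →
                      Tight m x i j ⇔ Tight m z i j
sameTight-unordered {m} x z {i} {j} same (1≤i , i<m) (1≤j , j<m) i+j≢m with ≤-total i j
... | inj₁ i≤j = same i j (1≤i , i≤j , j<m , i+j≢m)
... | inj₂ j≤i = ⇔.trans (tight-comm m x i j) (⇔.trans swapped (tight-comm m z j i))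
  where swapped : Tight m x j i ⇔ Tight m z j i
        swapped = same j i (1≤j , j≤i , i<m , i+j≢m ∘ trans (+-comm i j))

tightSet : ℕ → Point → ℕ → ℕ → Bool
tightSet m x i j = does (x (tgt m i j) ≟ℚ lhs m x i j)

relInt-tightSet : ∀ {m} x z → InRelaxedKunz m z → SameTight m x z → InRelInt m (tightSet m x) z
relInt-tightSet {m} x z z∈P same = (z∈P , tight-z) , maximal
  where
    tight-z : ∀ i j → ValidPair m i j → tightSet m x i j ≡ true → Tight m z i j
    tight-z i j v _ with x (tgt m i j) ≟ℚ lhs m x i j
    ... | yes tight = to (same i j v) tight
    maximal : ∀ J → InFace m J z → (∀ y → InFace m J y → InFace m (tightSet m x) y) →
              ∀ y → InFace m (tightSet m x) y → InFace m J y
    maximal J (_ , tight-J) _ y (y∈P , tight-y) =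
      y∈P , λ i j v Jij → tight-y i j v (dec-true (_ ≟ℚ _) (from (same i j v) (tight-J i j v Jij)))

-- x lies in F_{I ∪ {(i,j)}} ⊆ F_I, so relative interiority of x forces this face to be all of F_I.
relInt-transfer : ∀ {m I} x z → InRelInt m I x → InFace m I z →
                  ∀ i j → ValidPair m i j → Tight m x i j → Tight m z i j
relInt-transfer {m} {I} x z ((x∈P , tight-x) , maximal) z∈F i j v tight =
  proj₂ (maximal J x∈F-J F-J⊆F-I z z∈F) i j v J-ij
  where
    J : ℕ → ℕ → Bool
    J a b = I a b ∨ ((a ≡ᵇ i) ∧ (b ≡ᵇ j))
    J-ij : J i j ≡ true
    J-ij = to T-≡ (from T-∨ (inj₂ (from T-∧ (≡⇒≡ᵇ i i refl , ≡⇒≡ᵇ j j refl))))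
    x∈F-J : InFace m J x
    x∈F-J = x∈P , λ a b w J-ab → tight-x-J a b w (to T-∨ (from T-≡ J-ab))
      where
        tight-x-J : ∀ a b → ValidPair m a b → T (I a b) ⊎ T ((a ≡ᵇ i) ∧ (b ≡ᵇ j)) → Tight m x a b
        tight-x-J a b w (inj₁ I-ab) = tight-x a b w (to T-≡ I-ab)
        tight-x-J a b w (inj₂ ab≡ij)
          with refl ← ≡ᵇ⇒≡ a i (proj₁ (to T-∧ ab≡ij))
             | refl ← ≡ᵇ⇒≡ b j (proj₂ (to T-∧ ab≡ij)) = tight
    F-J⊆F-I : ∀ y → InFace m J y → InFace m I y
    F-J⊆F-I y (y∈P , tight-y) =
      y∈P , λ a b w I-ab → tight-y a b w (to T-≡ (from T-∨ (inj₁ (from T-≡ I-ab))))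

sameFace⇔sameTight : ∀ {m} x z → InRelaxedKunz m x → InRelaxedKunz m z →
                     Σ (ℕ → ℕ → Bool) (λ I → InRelInt m I x × InRelInt m I z) ⇔ SameTight m x z
sameFace⇔sameTight {m} x z x∈P z∈P = mk⇔ sameTight sameFace
  where
    sameTight : Σ (ℕ → ℕ → Bool) (λ I → InRelInt m I x × InRelInt m I z) → SameTight m x z
    sameTight (_ , x∈F° , z∈F°) i j v =
      mk⇔ (relInt-transfer x z x∈F° (proj₁ z∈F°) i j v) (relInt-transfer z x z∈F° (proj₁ x∈F°) i j v)
    sameFace : SameTight m x z → Σ (ℕ → ℕ → Bool) (λ I → InRelInt m I x × InRelInt m I z)
    sameFace same = tightSet m x , relInt-tightSet x x x∈P (λ _ _ _ → ⇔.refl) , relInt-tightSet x z z∈P same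

lhs-kunzPoint : ∀ m k i j → lhs m (kunzPoint k) i j ≡ fromℕ (k i + k j + carry m i j)
lhs-kunzPoint m k i j with i + j <ᵇ m
... | true  = sym (trans (cong fromℕ (+-identityʳ (k i + k j))) (fromℕ-+ (k i) (k j)))
... | false = sym (trans (fromℕ-+ (k i + k j) 1) (cong (_+ℚ 1ℚ) (fromℕ-+ (k i) (k j))))

tight-kunzPoint : ∀ m k i j → Tight m (kunzPoint k) i j ⇔ k (tgt m i j) ≡ k i + k j + carry m i j
tight-kunzPoint m k i j = mk⇔
  (λ tight → fromℕ-injective (trans tight (lhs-kunzPoint m k i j)))
  (λ eq → trans (cong fromℕ eq) (sym (lhs-kunzPoint m k i j)))

module KunzVector {S : ℕ → Set} (ns : NumericalSemigroup S) {m : ℕ} {k : ℕ → ℕ} (kv : IsKunzVector S m k) where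
  open NumericalSemigroup ns

  apery∈S : ∀ {i} → Index m i → S (apery m k i)
  apery∈S (1≤i , i<m) = proj₁ (kv _ 1≤i i<m)

  apery-minimal : ∀ {i} → Index m i → ∀ q → S (q * m + i) → k i ≤ q
  apery-minimal (1≤i , i<m) = proj₂ (kv _ 1≤i i<m)

  apery+apery : ∀ i j → apery m k i + apery m k j ≡ (k i + k j + carry m i j) * m + tgt m i j
  apery+apery i j = begin
    k i * m + i + (k j * m + j)                     ≡⟨ collect (k i) (k j) i j ⟩
    (k i + k j) * m + (i + j)                       ≡⟨ cong ((k i + k j) * m +_) (+≡tgt+carry*m m i j) ⟩
    (k i + k j) * m + (tgt m i j + carry m i j * m) ≡⟨ absorb (k i + k j) (tgt m i j) (carry m i j) ⟩
    (k i + k j + carry m i j) * m + tgt m i j       ∎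
    where open ≡-Reasoning
          collect : ∀ a b i j → a * m + i + (b * m + j) ≡ (a + b) * m + (i + j)
          collect a b i j = solve (a ∷ b ∷ i ∷ j ∷ m ∷ [])
          absorb : ∀ a t c → a * m + (t + c * m) ≡ (a + c) * m + t
          absorb a t c = solve (a ∷ t ∷ c ∷ m ∷ [])

  kunz-subadditive : ∀ {i j} → Index m i → Index m j → i + j ≢ m →
                     k (tgt m i j) ≤ k i + k j + carry m i j
  kunz-subadditive {i} {j} i∈ j∈ i+j≢m =
    apery-minimal (tgt-index i∈ j∈ i+j≢m) _
      (subst S (apery+apery i j) (closed _ _ (apery∈S i∈) (apery∈S j∈)))

  inRelaxedKunz : InRelaxedKunz m (kunzPoint k)
  inRelaxedKunz i j v@(_ , _ , _ , i+j≢m) =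
    subst (kunzPoint k (tgt m i j) ≤ℚ_) (sym (lhs-kunzPoint m k i j))
      (fromℕ-mono-≤ (kunz-subadditive (proj₁ (validPair⇒index v)) (proj₂ (validPair⇒index v)) i+j≢m))

  apery-difference : ∀ {i j s} → apery m k i + s ≡ apery m k (tgt m i j) →
                     (k i + carry m i j) * m + s ≡ k (tgt m i j) * m + j
  apery-difference {i} {j} {s} aᵢ+s≡aₜ = +-cancelʳ-≡ i _ _ (begin
    (k i + c) * m + s + i   ≡⟨ regroup (k i) c s i ⟩
    k i * m + i + s + c * m ≡⟨ cong (_+ c * m) aᵢ+s≡aₜ ⟩
    k t * m + t + c * m     ≡⟨ +-assoc (k t * m) t (c * m) ⟩
    k t * m + (t + c * m)   ≡⟨ cong (k t * m +_) (+≡tgt+carry*m m i j) ⟨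
    k t * m + (i + j)       ≡⟨ x∙yz≈xz∙y (k t * m) i j ⟩
    k t * m + j + i         ∎)
    where open ≡-Reasoning
          t c : ℕ
          t = tgt m i j
          c = carry m i j
          regroup : ∀ a c s i → (a + c) * m + s + i ≡ a * m + i + s + c * m
          regroup a c s i = solve (a ∷ c ∷ s ∷ i ∷ m ∷ [])

  tight⇔aperyLeq : ∀ {i j} → Index m i → Index m j → i + j ≢ m →
                   Tight m (kunzPoint k) i j ⇔ AperyLeq S m k i (tgt m i j)
  tight⇔aperyLeq {i} {j} i∈ j∈ i+j≢m =
    ⇔.trans (tight-kunzPoint m k i j) (mk⇔ tight⇒aperyLeq aperyLeq⇒tight)
    where
      t c : ℕ
      t = tgt m i j
      c = carry m i j

      tight⇒aperyLeq : k t ≡ k i + k j + c → AperyLeq S m k i t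
      tight⇒aperyLeq eq = apery m k j , apery∈S j∈ , trans (apery+apery i j) (cong (λ n → n * m + t) (sym eq))

      aperyLeq⇒tight : AperyLeq S m k i t → k t ≡ k i + k j + c
      aperyLeq⇒tight (s , s∈S , aᵢ+s≡aₜ)
        with q , [ki+c]+q≡kt , s≡q*m+j ←
               a*m+s≡b*m+r⇒s≡q*m+r (k i + c) (k t) s (proj₂ j∈) (apery-difference aᵢ+s≡aₜ)
        = ≤-antisym (kunz-subadditive i∈ j∈ i+j≢m) (begin
          k i + k j + c ≡⟨ xy∙z≈xz∙y (k i) (k j) c ⟩
          k i + c + k j ≤⟨ +-monoʳ-≤ (k i + c) (apery-minimal j∈ q (subst S s≡q*m+j s∈S)) ⟩
          k i + c + q   ≡⟨ [ki+c]+q≡kt ⟩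
          k t           ∎)
        where open ≤-Reasoning

aperyLeq-refl : ∀ {S} → NumericalSemigroup S → ∀ m k i → AperyLeq S m k i i
aperyLeq-refl ns m k i = 0 , NumericalSemigroup.zero∈ ns , +-identityʳ (apery m k i)

sameAperyPoset⇔sameTight : ∀ {m S T} kS kT → NumericalSemigroup S → NumericalSemigroup T →
                           IsKunzVector S m kS → IsKunzVector T m kT →
                           SameAperyPoset S kS T kT m ⇔ SameTight m (kunzPoint kS) (kunzPoint kT)
sameAperyPoset⇔sameTight {m} {S} {T} kS kT nS nT vS vT = mk⇔ sameTight samePoset
  where
    module KS = KunzVector nS vS
    module KT = KunzVector nT vT

    sameTight : SameAperyPoset S kS T kT m → SameTight m (kunzPoint kS) (kunzPoint kT)
    sameTight same i j v@(_ , _ , _ , i+j≢m) =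
      ⇔.trans (KS.tight⇔aperyLeq i∈ j∈ i+j≢m)
        (⇔.trans (same i (tgt m i j) (proj₁ i∈) (proj₂ i∈) (proj₁ t∈) (proj₂ t∈))
          (⇔.sym (KT.tight⇔aperyLeq i∈ j∈ i+j≢m)))
      where
        i∈ : Index m i
        i∈ = proj₁ (validPair⇒index v)
        j∈ : Index m j
        j∈ = proj₂ (validPair⇒index v)
        t∈ : Index m (tgt m i j)
        t∈ = tgt-index i∈ j∈ i+j≢m

    samePoset : SameTight m (kunzPoint kS) (kunzPoint kT) → SameAperyPoset S kS T kT m
    samePoset same i j 1≤i i<m 1≤j j<m with i ≟ j
    ... | yes refl = mk⇔ (λ _ → aperyLeq-refl nT m kT i) (λ _ → aperyLeq-refl nS m kS i)
    ... | no i≢j with d , d∈ , i+d≢m , tgt≡j ← tgt-onto (1≤i , i<m) (1≤j , j<m) i≢j =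
      subst (λ t → AperyLeq S m kS i t ⇔ AperyLeq T m kT i t) tgt≡j
        (⇔.trans (⇔.sym (KS.tight⇔aperyLeq (1≤i , i<m) d∈ i+d≢m))
          (⇔.trans (sameTight-unordered (kunzPoint kS) (kunzPoint kT) same (1≤i , i<m) d∈ i+d≢m)
            (KT.tight⇔aperyLeq (1≤i , i<m) d∈ i+d≢m)))

theorem3p10 : (m : ℕ) → 3 ≤ m → (S T : ℕ → Set) →
    NumericalSemigroup S → NumericalSemigroup T →
    Multiplicity S m → Multiplicity T m →
    (kS kT : ℕ → ℕ) → IsKunzVector S m kS → IsKunzVector T m kT →
    (Σ (ℕ → ℕ → Bool) (λ I → InRelInt m I (kunzPoint kS) × InRelInt m I (kunzPoint kT)))
      ⇔ SameAperyPoset S kS T kT m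
theorem3p10 m _ S T nS nT _ _ kS kT vS vT =
  ⇔.trans (sameFace⇔sameTight (kunzPoint kS) (kunzPoint kT)
            (KunzVector.inRelaxedKunz nS vS) (KunzVector.inRelaxedKunz nT vT))
          (⇔.sym (sameAperyPoset⇔sameTight kS kT nS nT vS vT))
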